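{- Let $(M,\in_1,\in_2)\models ZFC(\in_1)\cup ZFC(\in_2)$. For all $x,x',y,y'\in M$: if $\phi(x,y)$ and $\phi(x',y')$, then $x\in_1 x'\leftrightarrow y\in_2 y'$.
   Context: $ZFC(\in_1)$ denotes the first-order ZFC axioms with $\in_1$ as membership relation, where formulas in the schemas (Separation, Replacement) may contain both $\in_1$ and $\in_2$; $ZFC(\in_2)$ is symmetric. For $i=1,2$, $\mathrm{tr}_i(x)$ is the formula $\forall t\in_i x\,\forall w\in_i t\,(w\in_i x)$. $\mathrm{TC}_i(x)$ denotes the unique $u$ such that $\mathrm{tr}_i(u)$, $\forall v\in_i x\,(v\in_i u)$, and for every $v$ with $\mathrm{tr}_i(v)\wedge\forall w\in_i x\,(w\in_i v)$ we have $\forall w\in_i u\,(w\in_i v)$ (the $\in_i$-transitive closure of $x$); in $\mathrm{TC}_i(\{x\})$, $\{x\}$ is the singleton in the sense of $\in_i$. $\psi(x,y,f)$ is the conjunction of: (i) in the sense of $\in_1$, $f$ is a function with domain $\mathrm{TC}_1(\{x\})$; (ii) $\forall t\in_1\mathrm{TC}_1(x)\,(f(t)\in_2\mathrm{TC}_2(y))$; (iii) $\forall t\in_2\mathrm{TC}_2(y)\,\exists w\in_1\mathrm{TC}_1(x)\,(t=f(w))$; (iv) $\forall t\in_1\mathrm{TC}_1(x)\,\forall w\in_1\mathrm{TC}_1(\{x\})\,(t\in_1 w\leftrightarrow f(t)\in_2 f(w))$; (v) $f(x)=y$. Function application $f(t)$ is in the sense of $\in_1$. $\phi(x,y)$ is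 the formula $\exists f\,\psi(x,y,f)$. -}

module Defs where

open import Data.Nat using (ℕ; _≡ᵇ_)
open import Data.Bool using (if_then_else_)
open import Data.Product using (Σ; _×_; _,_)
open import Data.Sum using (_⊎_)
open import Data.Empty using (⊥)
open import Relation.Nullary using (¬_)
open import Relation.Binary.PropositionalEquality using (_≡_)

-- Two-sorted-membership first-order structures (M, ∈₁, ∈₂).
-- Equality of the object language is interpreted as identity of M.

data Idx : Set where
  one two : Idx

record Structure : Set₁ where
  field
    Carrier : Set
    rel     : Idx → Carrier → Carrier → Set

-- Classical (Goedel–Gentzen negative-translation) truth in a structure.
-- Atoms, disjunctions and existentials are double-negated, so that the
-- constructive metatheory computes exactly classical first-order truth.

infix 2 _⇔_
infixr 3 _∨ᶜ_
_⇔_ : Set → Set → Set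
A ⇔ B = (A → B) × (B → A)

∃ᶜ : {A : Set} → (A → Set) → Set
∃ᶜ {A} P = ¬ ¬ Σ A P

_∨ᶜ_ : Set → Set → Set
A ∨ᶜ B = ¬ ¬ (A ⊎ B)

data Fm : Set where
  mem     : Idx → ℕ → ℕ → Fm
  eql     : ℕ → ℕ → Fm
  fls     : Fm
  _⇒_     : Fm → Fm → Fm
  _∧_     : Fm → Fm → Fm
  _∨_     : Fm → Fm → Fm
  all     : ℕ → Fm → Fm
  ex      : ℕ → Fm → Fm

module InStructure (𝕄 : Structure) where
  open Structure 𝕄 public renaming (Carrier to M)

  Env : Set
  Env = ℕ → M

  _[_≔_] : Env → ℕ → M → Env
  (ρ [ v ≔ m ]) n = if n ≡ᵇ v then m else ρ n

  infix 4 _∈⟨_⟩_ _≐_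
  _∈⟨_⟩_ : M → Idx → M → Set
  x ∈⟨ i ⟩ y = ¬ ¬ rel i x y

  _≐_ : M → M → Set
  x ≐ y = ¬ ¬ (x ≡ y)

  Sat : Env → Fm → Set
  Sat ρ (mem i u v) = ρ u ∈⟨ i ⟩ ρ v
  Sat ρ (eql u v)   = ρ u ≐ ρ v
  Sat ρ fls         = ⊥
  Sat ρ (a ⇒ b)     = Sat ρ a → Sat ρ b
  Sat ρ (a ∧ b)     = Sat ρ a × Sat ρ b
  Sat ρ (a ∨ b)     = Sat ρ a ∨ᶜ Sat ρ b
  Sat ρ (all v a)   = (m : M) → Sat (ρ [ v ≔ m ]) a
  Sat ρ (ex v a)    = ∃ᶜ λ (m : M) → Sat (ρ [ v ≔ m ]) a

  -- Schemas range
  -- over all formulas θ of the language {∈₁, ∈₂, =}; the universal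
  -- closure over parameters is expressed by quantifying over all
  -- environments ρ (so the new set b never occurs in θ).

  module Axioms (i : Idx) where
    infix 4 _∈_
    _∈_ : M → M → Set
    x ∈ y = x ∈⟨ i ⟩ y

    Extensionality : Set
    Extensionality = (a b : M) → ((x : M) → (x ∈ a) ⇔ (x ∈ b)) → a ≐ b

    Foundation : Set
    Foundation = (a : M) → ∃ᶜ (λ x → x ∈ a) →
      ∃ᶜ λ x → x ∈ a × ¬ ∃ᶜ (λ y → y ∈ x × y ∈ a)

    Pairing : Set
    Pairing = (a b : M) → ∃ᶜ λ c → a ∈ c × b ∈ c

    Union : Set
    Union = (F : M) → ∃ᶜ λ A → (Y x : M) → x ∈ Y → Y ∈ F → x ∈ A

    PowerSet : Set
    PowerSet = (x : M) → ∃ᶜ λ y → (z : M) → ((w : M) → w ∈ z → w ∈ x) → z ∈ y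

    Infinity : Set
    Infinity = ∃ᶜ λ x →
      (∃ᶜ λ e → e ∈ x × ((w : M) → ¬ (w ∈ e))) ×
      ((y : M) → y ∈ x → ∃ᶜ λ s → s ∈ x × ((w : M) → (w ∈ s) ⇔ (w ∈ y ∨ᶜ w ≐ y)))

    Separation : Set
    Separation = (θ : Fm) (v : ℕ) (ρ : Env) (a : M) →
      ∃ᶜ λ b → (x : M) → (x ∈ b) ⇔ (x ∈ a × Sat (ρ [ v ≔ x ]) θ)

    Replacement : Set
    Replacement = (θ : Fm) (u v : ℕ) (ρ : Env) (a : M) →
      ((x : M) → x ∈ a → ∃ᶜ λ y → Sat ((ρ [ u ≔ x ]) [ v ≔ y ]) θ ×
          ((z : M) → Sat ((ρ [ u ≔ x ]) [ v ≔ z ]) θ → z ≐ y)) →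
      ∃ᶜ λ b → (x : M) → x ∈ a → ∃ᶜ λ y → y ∈ b × Sat ((ρ [ u ≔ x ]) [ v ≔ y ]) θ

    Choice : Set
    Choice = (F : M) →
      ((x : M) → x ∈ F → ∃ᶜ λ y → y ∈ x) →
      ((x x' : M) → x ∈ F → x' ∈ F → ¬ (x ≐ x') → ¬ ∃ᶜ (λ z → z ∈ x × z ∈ x')) →
      ∃ᶜ λ C → (x : M) → x ∈ F →
        ∃ᶜ λ z → (z ∈ x × z ∈ C) × ((z' : M) → z' ∈ x × z' ∈ C → z' ≐ z)

  record ZFC (i : Idx) : Set where
    open Axioms i
    field
      extensionality : Extensionality
      foundation     : Foundation
      pairing        : Pairing
      union          : Union
      powerSet       : PowerSet
      infinity       : Infinity
      separation     : Separation
      replacement    : Replacement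
      choice         : Choice

  -- Defined notions used in φ (all classical, relational renderings of
  -- the defined terms {a}, {a,b}, ⟨a,b⟩, TCᵢ, f(t)).

  IsSingleton : Idx → M → M → Set
  IsSingleton i s a = (w : M) → (w ∈⟨ i ⟩ s) ⇔ (w ≐ a)

  IsUPair : Idx → M → M → M → Set
  IsUPair i p a b = (w : M) → (w ∈⟨ i ⟩ p) ⇔ (w ≐ a ∨ᶜ w ≐ b)

  IsOPair : Idx → M → M → M → Set
  IsOPair i p a b = (w : M) → (w ∈⟨ i ⟩ p) ⇔ (IsSingleton i w a ∨ᶜ IsUPair i w a b)

  tr : Idx → M → Set
  tr i x = (t : M) → t ∈⟨ i ⟩ x → (w : M) → w ∈⟨ i ⟩ t → w ∈⟨ i ⟩ x

  IsTC : Idx → M → M → Set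
  IsTC i x u = tr i u × ((v : M) → v ∈⟨ i ⟩ x → v ∈⟨ i ⟩ u) ×
    ((v : M) → tr i v → ((w : M) → w ∈⟨ i ⟩ x → w ∈⟨ i ⟩ v) →
       (w : M) → w ∈⟨ i ⟩ u → w ∈⟨ i ⟩ v)

  InTC : Idx → M → M → Set
  InTC i t x = ∃ᶜ λ u → IsTC i x u × t ∈⟨ i ⟩ u

  InTCs : Idx → M → M → Set
  InTCs i t x = ∃ᶜ λ s → IsSingleton i s x × InTC i t s

  App : M → M → M → Set
  App f t z = ∃ᶜ λ p → IsOPair one p t z × p ∈⟨ one ⟩ f

  IsFunOnTCs : M → M → Set
  IsFunOnTCs f x =
    ((p : M) → p ∈⟨ one ⟩ f → ∃ᶜ λ a → ∃ᶜ λ b → IsOPair one p a b) ×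
    ((a b b' : M) → App f a b → App f a b' → b ≐ b') ×
    ((a : M) → InTCs one a x ⇔ ∃ᶜ (λ b → App f a b))

  ψ : M → M → M → Set
  ψ x y f =
    IsFunOnTCs f x ×
    ((t : M) → InTC one t x → ∃ᶜ λ z → App f t z × InTC two z y) ×
    ((t : M) → InTC two t y → ∃ᶜ λ w → InTC one w x × App f w t) ×
    ((t : M) → InTC one t x → (w : M) → InTCs one w x →
       (t ∈⟨ one ⟩ w) ⇔ (∃ᶜ λ z → ∃ᶜ λ z' → App f t z × App f w z' × z ∈⟨ two ⟩ z')) ×
    App f x y

  φ : M → M → Set
  φ x y = ∃ᶜ λ f → ψ x y f

-- The witnesses f : TC₁({x}) → TC₂({y}) and f' : TC₁({x'}) → TC₂({y'}) are
-- ∈-isomorphisms.  By ∈₁-induction they agree on the common part of their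
-- domains, and by ∈₂-induction their inverses agree on the common part of their
-- ranges.  If x ∈₁ x', then x lies in both domains, so f'(x) = f(x) = y and f'
-- carries x ∈₁ x' to y ∈₂ y'.  If y ∈₂ y', then y = f'(w) for some w ∈₁ TC₁(x'),
-- the inverses agree at y, so w = x and x ∈₁ x'.  Transitive closures exist by
-- the usual recursion y, ⋃y, ⋃⋃y, … along an inductive set (Infinity and
-- Replacement).  Truth in M is the negative translation, so every goal is a
-- stable proposition and classical case analysis is available throughout.

module Submission where

open import Defs
open import Function using (id; const)
open import Data.Nat using (ℕ)
open import Data.Product using (_×_; _,_; proj₁; proj₂)
open import Data.Sum using (inj₁; inj₂; map₂)
open import Data.Empty using (⊥; ⊥-elim)
open import Relation.Nullary.Negation.Core using (¬_; Stable; negated-stable; ¬¬-map)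
open import Relation.Binary.PropositionalEquality using (refl; sym; trans)

private variable
  A B C : Set

⊥-stable : Stable ⊥
⊥-stable ¬¬⊥ = ¬¬⊥ id

×-stable : Stable A → Stable B → Stable (A × B)
×-stable sa sb ¬¬ab =
  sa (λ ¬a → ¬¬ab (λ ab → ¬a (proj₁ ab))) , sb (λ ¬b → ¬¬ab (λ ab → ¬b (proj₂ ab)))

Π-stable : {B : A → Set} → ((a : A) → Stable (B a)) → Stable ((a : A) → B a)
Π-stable sb ¬¬f a = sb a (λ ¬b → ¬¬f (λ f → ¬b (f a)))

→-stable : Stable B → Stable (A → B)
→-stable sb = Π-stable (λ _ → sb)

⇔-stable : Stable A → Stable B → Stable (A ⇔ B)
⇔-stable sa sb = ×-stable (→-stable sb) (→-stable sa)

¬¬-rec : Stable B → (A → B) → ¬ ¬ A → B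
¬¬-rec sb f ¬¬a = sb (λ ¬b → ¬¬a (λ a → ¬b (f a)))

∨ᶜ-case : Stable C → A ∨ᶜ B → (A → C) → (B → C) → C
∨ᶜ-case sc d f g = ¬¬-rec sc (λ { (inj₁ a) → f a ; (inj₂ b) → g b }) d

∨ᶜ-inj₁ : A → A ∨ᶜ B
∨ᶜ-inj₁ a k = k (inj₁ a)

∨ᶜ-inj₂ : B → A ∨ᶜ B
∨ᶜ-inj₂ b k = k (inj₂ b)

∃ᶜ-intro : {P : A → Set} (a : A) → P a → ∃ᶜ P
∃ᶜ-intro a pa k = k (a , pa)

_⇔ᶠ_ : Fm → Fm → Fm
θ ⇔ᶠ θ' = (θ ⇒ θ') ∧ (θ' ⇒ θ)

¬ᶠ_ : Fm → Fm
¬ᶠ θ = θ ⇒ fls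

-- Variables 20–32 serve as the bound variables of these encodings; parameters
-- passed to them must therefore avoid that range.

singletonᶠ : Idx → ℕ → ℕ → ℕ → Fm
singletonᶠ i s a w = all w (mem i w s ⇔ᶠ eql w a)

upairᶠ : Idx → ℕ → ℕ → ℕ → ℕ → Fm
upairᶠ i p a b w = all w (mem i w p ⇔ᶠ (eql w a ∨ eql w b))

opairᶠ : Idx → ℕ → ℕ → ℕ → ℕ → ℕ → Fm
opairᶠ i p a b w v = all w (mem i w p ⇔ᶠ (singletonᶠ i w a v ∨ upairᶠ i w a b v))

pairInᶠ : Idx → ℕ → ℕ → ℕ → Fm
pairInᶠ i g a b = ex 24 (opairᶠ i 24 a b 25 26 ∧ mem i 24 g)

emptyᶠ : Idx → ℕ → ℕ → Fm
emptyᶠ i k w = all w (¬ᶠ mem i w k)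

succᶠ : Idx → ℕ → ℕ → ℕ → Fm
succᶠ i k j w = all w (mem i w k ⇔ᶠ (mem i w j ∨ eql w j))

unionᶠ : Idx → ℕ → ℕ → ℕ → ℕ → Fm
unionᶠ i U V w Y = all w (mem i w U ⇔ᶠ ex Y (mem i w Y ∧ mem i Y V))

chainᶠ : Idx → ℕ → ℕ → ℕ → Fm
chainᶠ i n g y =
  all 20 (all 21 (pairInᶠ i g 20 21 ⇒ (mem i 20 n ∨ eql 20 n))) ∧
  (all 20 (all 21 (pairInᶠ i g 20 21 ⇒
     (emptyᶠ i 20 27 ∨ ex 22 (succᶠ i 20 22 27 ∧ ex 23 (pairInᶠ i g 22 23))))) ∧
  (all 20 (all 21 (pairInᶠ i g 20 21 ⇒ (emptyᶠ i 20 27 ⇒ eql 21 y))) ∧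
  (all 20 (all 21 (all 22 (all 23 (pairInᶠ i g 20 21 ⇒
     (succᶠ i 20 22 27 ⇒ (pairInᶠ i g 22 23 ⇒ unionᶠ i 21 23 27 28)))))) ∧
  ex 21 (pairInᶠ i g n 21))))

transitiveᶠ : Idx → ℕ → Fm
transitiveᶠ i S = all 31 (mem i 31 S ⇒ all 32 (mem i 32 31 ⇒ mem i 32 S))

module Theory (𝕄 : Structure) where
  open InStructure 𝕄

  private variable
    i : Idx
    a a' b b' c d e f f' g g' j j' k k' m n p q s s' t u u' w x x' y y' z z' U U' V V' W : M

  Sat-stable : (ρ : Env) (θ : Fm) → Stable (Sat ρ θ)
  Sat-stable ρ (mem i u v) = negated-stable
  Sat-stable ρ (eql u v)   = negated-stable
  Sat-stable ρ fls         = ⊥-stable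
  Sat-stable ρ (θ ⇒ θ')    = →-stable (Sat-stable ρ θ')
  Sat-stable ρ (θ ∧ θ')    = ×-stable (Sat-stable ρ θ) (Sat-stable ρ θ')
  Sat-stable ρ (θ ∨ θ')    = negated-stable
  Sat-stable ρ (all v θ)   = Π-stable (λ m → Sat-stable (ρ [ v ≔ m ]) θ)
  Sat-stable ρ (ex v θ)    = negated-stable

  ≐-refl : a ≐ a
  ≐-refl k = k refl

  ≐-sym : a ≐ b → b ≐ a
  ≐-sym e k = e (λ p → k (sym p))

  ≐-trans : a ≐ b → b ≐ c → a ≐ c
  ≐-trans e e' k = e (λ p → e' (λ p' → k (trans p p')))

  ≐-subst : (P : M → Set) → (∀ {x} → Stable (P x)) → a ≐ b → P a → P b
  ≐-subst P sP e pa = sP (λ ¬pb → e (λ { refl → ¬pb pa }))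

  ∈-substˡ : a ≐ b → a ∈⟨ i ⟩ c → b ∈⟨ i ⟩ c
  ∈-substˡ {i = i} {c = c} = ≐-subst (λ x → x ∈⟨ i ⟩ c) negated-stable

  ∈-substʳ : b ≐ c → a ∈⟨ i ⟩ b → a ∈⟨ i ⟩ c
  ∈-substʳ {a = a} {i = i} = ≐-subst (λ x → a ∈⟨ i ⟩ x) negated-stable

  ¬⇔¬-stable : Stable (¬ A ⇔ ¬ B)
  ¬⇔¬-stable = ⇔-stable negated-stable negated-stable

  -- ⟨a, b⟩ ∈ᵢ g; App f is definitionally PairIn one f
  PairIn : Idx → M → M → M → Set
  PairIn i g a b = ∃ᶜ λ p → IsOPair i p a b × p ∈⟨ i ⟩ g

  PairIn-substˡ : a ≐ a' → PairIn i g a b → PairIn i g a' b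
  PairIn-substˡ {i = i} {g = g} {b = b} = ≐-subst (λ x → PairIn i g x b) negated-stable

  φ-rec₂ : Stable B → φ x y → φ x' y' → ({f f' : M} → ψ x y f → ψ x' y' f' → B) → B
  φ-rec₂ sb φxy φx'y' k = ¬¬-rec sb (λ { (_ , h) → ¬¬-rec sb (λ { (_ , h') → k h h' }) φx'y' }) φxy

  module ZF (i : Idx) (Z : ZFC i) where
    open ZFC Z
    open Axioms i using (_∈_)

    IsEmpty : M → Set
    IsEmpty k = (w : M) → ¬ (w ∈ k)

    IsSucc : M → M → Set
    IsSucc k j = (w : M) → (w ∈ k) ⇔ (w ∈ j ∨ᶜ w ≐ j)

    IsUnion : M → M → Set
    IsUnion U V = (w : M) → (w ∈ U) ⇔ ∃ᶜ (λ Y → w ∈ Y × Y ∈ V)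

    IsBinUnion : M → M → M → Set
    IsBinUnion u a b = (w : M) → (w ∈ u) ⇔ (w ∈ a ∨ᶜ w ∈ b)

    comprehension : (θ : Fm) (ρ : Env) (c : M) → ((w : M) → Sat (ρ [ 0 ≔ w ]) θ → w ∈ c) →
      ∃ᶜ λ b → (w : M) → (w ∈ b) ⇔ Sat (ρ [ 0 ≔ w ]) θ
    comprehension θ ρ c bounded k = separation θ 0 ρ c λ { (b , hb) →
      k (b , λ w → (λ w∈b → proj₂ (proj₁ (hb w) w∈b))
                 , (λ θw → proj₂ (hb w) (bounded w θw , θw))) }

    ≐-by-members : {P : M → Set} →
      ((w : M) → (w ∈ s) ⇔ P w) → ((w : M) → (w ∈ s') ⇔ P w) → s ≐ s'
    ≐-by-members h h' = extensionality _ _ λ w →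
      (λ w∈s → proj₂ (h' w) (proj₁ (h w) w∈s)) , (λ w∈s' → proj₂ (h w) (proj₁ (h' w) w∈s'))

    ⊆-antisym : ((w : M) → w ∈ a → w ∈ b) → ((w : M) → w ∈ b → w ∈ a) → a ≐ b
    ⊆-antisym a⊆b b⊆a = extensionality _ _ λ w → a⊆b w , b⊆a w

    singleton-exists : (a : M) → ∃ᶜ λ s → IsSingleton i s a
    singleton-exists a k = pairing a a λ { (c , a∈c , _) →
      comprehension (eql 0 1) (const a) c (λ w w≐a → ∈-substˡ (≐-sym w≐a) a∈c) k }

    upair-exists : (a b : M) → ∃ᶜ λ p → IsUPair i p a b
    upair-exists a b k = pairing a b λ { (c , a∈c , b∈c) →
      comprehension (eql 0 1 ∨ eql 0 2) (const a [ 2 ≔ b ]) c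
        (λ w w≐ → ∨ᶜ-case negated-stable w≐
           (λ w≐a → ∈-substˡ (≐-sym w≐a) a∈c) (λ w≐b → ∈-substˡ (≐-sym w≐b) b∈c)) k }

    binunion-exists : (a b : M) → ∃ᶜ λ u → IsBinUnion u a b
    binunion-exists a b k = pairing a b λ { (c , a∈c , b∈c) → union c λ { (A , hA) →
      comprehension (mem i 0 1 ∨ mem i 0 2) (const a [ 2 ≔ b ]) A
        (λ w w∈ → ∨ᶜ-case negated-stable w∈
           (λ w∈a → hA a w w∈a a∈c) (λ w∈b → hA b w w∈b b∈c)) k } }

    union-exists : (V : M) → ∃ᶜ λ U → IsUnion U V
    union-exists V k = union V λ { (A , hA) →
      comprehension (ex 3 (mem i 0 3 ∧ mem i 3 1)) (const V) A
        (λ w ∃Y ¬w∈A → ∃Y λ { (Y , w∈Y , Y∈V) → hA Y w w∈Y Y∈V ¬w∈A }) k }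

    singleton-∋ : IsSingleton i s a → a ∈ s
    singleton-∋ {a = a} h = proj₂ (h a) ≐-refl

    singleton-≐ : IsSingleton i s a → w ∈ s → w ≐ a
    singleton-≐ {w = w} h = proj₁ (h w)

    upair-∋ˡ : IsUPair i p a b → a ∈ p
    upair-∋ˡ {a = a} h = proj₂ (h a) (∨ᶜ-inj₁ ≐-refl)

    upair-∋ʳ : IsUPair i p a b → b ∈ p
    upair-∋ʳ {b = b} h = proj₂ (h b) (∨ᶜ-inj₂ ≐-refl)

    upair-≐ : IsUPair i p a b → w ∈ p → w ≐ a ∨ᶜ w ≐ b
    upair-≐ {w = w} h = proj₁ (h w)

    ∈-asym : a ∈ b → b ∈ a → ⊥
    ∈-asym {a = a} {b = b} a∈b b∈a = upair-exists a b λ { (p , hp) →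
      foundation p (∃ᶜ-intro a (upair-∋ˡ hp)) λ { (m , m∈p , minimal) →
        ∨ᶜ-case ⊥-stable (upair-≐ hp m∈p)
          (λ m≐a → minimal (∃ᶜ-intro b (∈-substʳ (≐-sym m≐a) b∈a , upair-∋ʳ hp)))
          (λ m≐b → minimal (∃ᶜ-intro a (∈-substʳ (≐-sym m≐b) a∈b , upair-∋ˡ hp))) } }

    ∈-irrefl : ¬ (a ∈ a)
    ∈-irrefl a∈a = ∈-asym a∈a a∈a

    opair-exists : (a b : M) → ∃ᶜ λ p → IsOPair i p a b
    opair-exists a b k = singleton-exists a λ { (sa , hsa) → upair-exists a b λ { (pab , hpab) →
      pairing sa pab λ { (c , sa∈c , pab∈c) →
      comprehension (singletonᶠ i 0 1 20 ∨ upairᶠ i 0 1 2 20) (const a [ 2 ≔ b ]) c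
        (λ w w≐ → ∨ᶜ-case negated-stable w≐
           (λ hs → ∈-substˡ (≐-by-members hsa hs) sa∈c)
           (λ hp → ∈-substˡ (≐-by-members hpab hp) pab∈c)) k } } }

    opair-∋ : IsOPair i p a b → q ∈ p → a ∈ q
    opair-∋ hp q∈p = ∨ᶜ-case negated-stable (proj₁ (hp _) q∈p) singleton-∋ upair-∋ˡ

    opair-≐ : IsOPair i p a b → q ∈ p → w ∈ q → w ≐ a ∨ᶜ w ≐ b
    opair-≐ hp q∈p w∈q = ∨ᶜ-case negated-stable (proj₁ (hp _) q∈p)
      (λ hs → ∨ᶜ-inj₁ (singleton-≐ hs w∈q)) (λ hu → upair-≐ hu w∈q)

    opair-injective : IsOPair i p a b → IsOPair i p c d → a ≐ c × b ≐ d
    opair-injective {p = p} {a = a} {b = b} {c = c} {d = d} hp hq = a≐c , b≐d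
      where
      a≐c : a ≐ c
      a≐c ¬a≡c = singleton-exists a λ { (sa , hsa) →
        ≐-sym (singleton-≐ hsa (opair-∋ hq (proj₂ (hp sa) (∨ᶜ-inj₁ hsa)))) ¬a≡c }

      member-of-other : {c' d' a' b' : M} →
        IsOPair i p c' d' → IsOPair i p a' b' → d' ≐ a' ∨ᶜ d' ≐ b'
      member-of-other {c'} {d'} hq' hp' k = upair-exists c' d' λ { (e , he) →
        opair-≐ hp' (proj₂ (hq' e) (∨ᶜ-inj₂ he)) (upair-∋ʳ he) k }

      b≐d : b ≐ d
      b≐d = ∨ᶜ-case negated-stable (member-of-other hp hq)
        (λ b≐c → ∨ᶜ-case negated-stable (member-of-other hq hp)
           (λ d≐a → ≐-trans b≐c (≐-trans (≐-sym a≐c) (≐-sym d≐a)))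
           ≐-sym)
        id

    IsOPair-stable : Stable (IsOPair i p a b)
    IsOPair-stable = Π-stable λ _ → ¬⇔¬-stable

    PairIn-singleton : IsSingleton i g p → IsOPair i p a b → PairIn i g c d → c ≐ a × d ≐ b
    PairIn-singleton hg hp = ¬¬-rec (×-stable negated-stable negated-stable) λ { (q , hq , q∈g) →
      opair-injective (≐-subst (λ x → IsOPair i x _ _) IsOPair-stable (singleton-≐ hg q∈g) hq) hp }

    succ-∋ : IsSucc k j → j ∈ k
    succ-∋ {j = j} h = proj₂ (h j) (∨ᶜ-inj₂ ≐-refl)

    succ-exists : (n : M) → ∃ᶜ λ s → IsSucc s n
    succ-exists n k = singleton-exists n λ { (sn , hsn) → binunion-exists n sn λ { (u , hu) →
      k (u , λ w →
           (λ w∈u → ∨ᶜ-case negated-stable (proj₁ (hu w) w∈u)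
              ∨ᶜ-inj₁ (λ w∈sn → ∨ᶜ-inj₂ (singleton-≐ hsn w∈sn)))
         , (λ w∈ → proj₂ (hu w) (∨ᶜ-case negated-stable w∈
              ∨ᶜ-inj₁ (λ w≐n → ∨ᶜ-inj₂ (∈-substˡ (≐-sym w≐n) (singleton-∋ hsn)))))) } }

    succ-injective : IsSucc k j → IsSucc k j' → j ≐ j'
    succ-injective {j = j} {j' = j'} h h' = ∨ᶜ-case negated-stable (proj₁ (h' j) (succ-∋ h))
      (λ j∈j' → ∨ᶜ-case negated-stable (proj₁ (h j') (succ-∋ h'))
         (λ j'∈j → ⊥-elim (∈-asym j∈j' j'∈j))
         ≐-sym)
      id

    IsEmpty-stable : Stable (IsEmpty k)
    IsEmpty-stable = Π-stable λ _ → negated-stable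

    IsSucc-stable : Stable (IsSucc k j)
    IsSucc-stable = Π-stable λ _ → ¬⇔¬-stable

    IsSucc-substˡ : k ≐ k' → IsSucc k j → IsSucc k' j
    IsSucc-substˡ {j = j} = ≐-subst (λ x → IsSucc x j) IsSucc-stable

    IsUnion-stable : Stable (IsUnion U V)
    IsUnion-stable = Π-stable λ _ → ¬⇔¬-stable

    IsUnion-cong : U ≐ U' → V ≐ V' → IsUnion U V → IsUnion U' V'
    IsUnion-cong {U' = U'} {V = V} U≐U' V≐V' h =
      ≐-subst (λ x → IsUnion U' x) IsUnion-stable V≐V'
        (≐-subst (λ x → IsUnion x V) IsUnion-stable U≐U' h)

    union-unique : IsUnion U V → IsUnion U' V → U ≐ U'
    union-unique = ≐-by-members

    minimal-counterexample : (θ : Fm) (ρ : Env) (S a : M) → a ∈ S → ¬ Sat (ρ [ 0 ≔ a ]) θ →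
      ∃ᶜ λ m → (m ∈ S × ¬ Sat (ρ [ 0 ≔ m ]) θ) × ((w : M) → w ∈ m → w ∈ S → Sat (ρ [ 0 ≔ w ]) θ)
    minimal-counterexample θ ρ S a a∈S ¬θa κ = separation (¬ᶠ θ) 0 ρ S λ { (B , hB) →
      foundation B (∃ᶜ-intro a (proj₂ (hB a) (a∈S , ¬θa))) λ { (m , m∈B , minimal) →
        κ (m , proj₁ (hB m) m∈B , λ w w∈m w∈S → Sat-stable _ θ λ ¬θw →
          minimal (∃ᶜ-intro w (w∈m , proj₂ (hB w) (w∈S , ¬θw)))) } }

    ∈-induction : (U : M) → tr i U → (θ : Fm) (ρ : Env) →
      ((t : M) → t ∈ U → ((w : M) → w ∈ t → Sat (ρ [ 0 ≔ w ]) θ) → Sat (ρ [ 0 ≔ t ]) θ) →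
      (t : M) → t ∈ U → Sat (ρ [ 0 ≔ t ]) θ
    ∈-induction U U-tr θ ρ step t t∈U = Sat-stable _ θ λ ¬θt →
      minimal-counterexample θ ρ U t t∈U ¬θt λ { (m , (m∈U , ¬θm) , below) →
        ¬θm (step m m∈U λ w w∈m → below w w∈m (U-tr m m∈U w w∈m)) }

    -- A chain up to n lists y, ⋃y, ⋃⋃y, … at the stages ∅, ∅⁺, … , n.  It is not
    -- required to be single-valued: that follows by foundation (chain-unique).
    module UnionChain (y : M) where
      Bounded : M → M → Set
      Bounded n g = (k U : M) → PairIn i g k U → k ∈ n ∨ᶜ k ≐ n

      Grounded : M → Set
      Grounded g = (k U : M) → PairIn i g k U →
        IsEmpty k ∨ᶜ ∃ᶜ (λ j → IsSucc k j × ∃ᶜ λ W → PairIn i g j W)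

      Starts : M → Set
      Starts g = (k U : M) → PairIn i g k U → IsEmpty k → U ≐ y

      Steps : M → Set
      Steps g = (k U j W : M) → PairIn i g k U → IsSucc k j → PairIn i g j W → IsUnion U W

      IsChain : M → M → Set
      IsChain n g = Bounded n g × Grounded g × Starts g × Steps g × ∃ᶜ (λ U → PairIn i g n U)

      Stage : M → M → Set
      Stage n V = ∃ᶜ λ g → IsChain n g × PairIn i g n V

      chain-step : Grounded g → Starts g → Steps g → Grounded g' → Starts g' → Steps g' →
        PairIn i g m V → PairIn i g' m V' →
        ((j W W' : M) → j ∈ m → PairIn i g j W → PairIn i g' j W' → W ≐ W') → V ≐ V'
      chain-step grounded starts steps grounded' starts' steps' pV pV' below =
        ∨ᶜ-case negated-stable (grounded _ _ pV)
          (λ m-empty → ≐-trans (starts _ _ pV m-empty) (≐-sym (starts' _ _ pV' m-empty)))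
          (¬¬-rec negated-stable λ { (j , m=j⁺ , ∃W) → ¬¬-rec negated-stable (λ { (W , pW) →
            ∨ᶜ-case negated-stable (grounded' _ _ pV')
              (λ m-empty → ⊥-elim (m-empty j (succ-∋ m=j⁺)))
              (¬¬-rec negated-stable λ { (j' , m=j'⁺ , ∃W') → ¬¬-rec negated-stable (λ { (W' , pW') →
                let pW'ⱼ = PairIn-substˡ (≐-sym (succ-injective m=j⁺ m=j'⁺)) pW'
                in union-unique (steps _ _ _ _ pV m=j⁺ pW)
                     (IsUnion-cong ≐-refl (≐-sym (below j W W' (succ-∋ m=j⁺) pW pW'ⱼ))
                        (steps' _ _ _ _ pV' m=j⁺ pW'ⱼ)) }) ∃W' }) }) ∃W })

      chain-unique : IsChain n g → IsChain n g' → PairIn i g k U → PairIn i g' k U' → U ≐ U'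
      chain-unique {n = n} {g = g} {g' = g'} {k = k}
        (bounded , grounded , starts , steps , _) (_ , grounded' , starts' , steps' , _) pU pU' ¬U≡U' =
        succ-exists n λ { (S , hS) →
          let dom⊆S : {m W : M} → PairIn i g m W → m ∈ S
              dom⊆S pW = proj₂ (hS _) (bounded _ _ pW)
          in minimal-counterexample θ (const g [ 3 ≔ g' ]) S k (dom⊆S pU)
               (λ agree → agree _ _ (pU , pU') ¬U≡U')
               λ { (m , (_ , ¬agree-at-m) , below) → ¬agree-at-m λ { V V' (pV , pV') →
                 chain-step grounded starts steps grounded' starts' steps' pV pV'
                   λ j W W' j∈m pW pW' → below j j∈m (dom⊆S pW) W W' (pW , pW') } } }
        where
        θ : Fm
        θ = all 21 (all 29 ((pairInᶠ i 1 0 21 ∧ pairInᶠ i 3 0 29) ⇒ eql 21 29))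

      stage-unique : Stage n V → Stage n V' → V ≐ V'
      stage-unique sV sV' ¬V≡V' =
        sV λ { (g , c , pV) → sV' λ { (g' , c' , pV') → chain-unique c c' pV pV' ¬V≡V' } }

      stage-chain : Stage n V → ∃ᶜ λ g → IsChain n g
      stage-chain = ¬¬-map λ { (g , c , _) → g , c }

      chain-stage : IsChain n g → ∃ᶜ λ V → Stage n V
      chain-stage {g = g} c@(_ , _ , _ , _ , reaches) =
        ¬¬-map (λ { (V , pV) → V , ∃ᶜ-intro g (c , pV) }) reaches

      chain-base : IsEmpty e → Stage e y
      chain-base {e = e} e-empty κ = opair-exists e y λ { (p , hp) → singleton-exists p λ { (g , hg) →
        let only : ∀ {k U} → PairIn i g k U → k ≐ e × U ≐ y
            only = PairIn-singleton hg hp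
            k-empty : ∀ {k U} → PairIn i g k U → IsEmpty k
            k-empty h = ≐-subst IsEmpty IsEmpty-stable (≐-sym (proj₁ (only h))) e-empty
            ey∈g : PairIn i g e y
            ey∈g = ∃ᶜ-intro p (hp , singleton-∋ hg)
        in κ (g , ( (λ _ _ h → ∨ᶜ-inj₂ (proj₁ (only h)))
                  , (λ _ _ h → ∨ᶜ-inj₁ (k-empty h))
                  , (λ _ _ h _ → proj₂ (only h))
                  , (λ _ _ j _ h k=j⁺ _ → ⊥-elim (k-empty h j (succ-∋ k=j⁺)))
                  , ∃ᶜ-intro y ey∈g )
                , ey∈g) } }

      -- g' = g ∪ {⟨s, V'⟩} continues a chain reaching V at n by V' = ⋃V at s = n⁺.
      module Extension {n g V s V' p g₁ g' : M}
        (bounded : Bounded n g) (grounded : Grounded g) (starts : Starts g) (steps : Steps g)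
        (single-valued : ∀ {k U U'} → PairIn i g k U → PairIn i g k U' → U ≐ U')
        (pV : PairIn i g n V) (s=n⁺ : IsSucc s n) (hV' : IsUnion V' V)
        (hp : IsOPair i p s V') (hg₁ : IsSingleton i g₁ p) (hg' : IsBinUnion g' g g₁) where

        old-pair : PairIn i g k U → PairIn i g' k U
        old-pair = ¬¬-map λ { (q , hq , q∈g) → q , hq , proj₂ (hg' q) (∨ᶜ-inj₁ q∈g) }

        new-pair : PairIn i g' s V'
        new-pair = ∃ᶜ-intro p (hp , proj₂ (hg' p) (∨ᶜ-inj₂ (singleton-∋ hg₁)))

        pair-cases : PairIn i g' k U → PairIn i g k U ∨ᶜ (k ≐ s × U ≐ V')
        pair-cases h κ = h λ { (q , hq , q∈g') → ∨ᶜ-case ⊥-stable (proj₁ (hg' q) q∈g')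
          (λ q∈g → κ (inj₁ (∃ᶜ-intro q (hq , q∈g))))
          (λ q∈g₁ → κ (inj₂ (PairIn-singleton hg₁ hp (∃ᶜ-intro q (hq , q∈g₁))))) }

        s-fresh : ¬ PairIn i g s W
        s-fresh h = ∨ᶜ-case ⊥-stable (bounded _ _ h)
          (λ s∈n → ∈-asym s∈n (succ-∋ s=n⁺))
          (λ s≐n → ∈-irrefl (∈-substʳ s≐n (succ-∋ s=n⁺)))

        s-not-predecessor : PairIn i g k U → IsSucc k j → ¬ (j ≐ s)
        s-not-predecessor h k=j⁺ j≐s = ∨ᶜ-case ⊥-stable (grounded _ _ h)
          (λ k-empty → k-empty _ (succ-∋ k=j⁺))
          (¬¬-rec ⊥-stable λ { (j' , k=j'⁺ , ∃W) → ¬¬-rec ⊥-stable (λ { (W , pW) →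
             s-fresh (PairIn-substˡ (≐-trans (≐-sym (succ-injective k=j⁺ k=j'⁺)) j≐s) pW) }) ∃W })

        bounded' : Bounded s g'
        bounded' k U h = ∨ᶜ-case negated-stable (pair-cases h)
          (λ old → ∨ᶜ-inj₁ (proj₂ (s=n⁺ k) (bounded k U old)))
          (λ new → ∨ᶜ-inj₂ (proj₁ new))

        grounded' : Grounded g'
        grounded' k U h = ∨ᶜ-case negated-stable (pair-cases h)
          (λ old → ¬¬-map (map₂ (¬¬-map λ { (j , k=j⁺ , ∃W) →
                      j , k=j⁺ , ¬¬-map (λ { (W , pW) → W , old-pair pW }) ∃W }))
                    (grounded k U old))
          (λ new → ∨ᶜ-inj₂ (∃ᶜ-intro n (IsSucc-substˡ (≐-sym (proj₁ new)) s=n⁺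
                                       , ∃ᶜ-intro V (old-pair pV))))

        starts' : Starts g'
        starts' k U h k-empty = ∨ᶜ-case negated-stable (pair-cases h)
          (λ old → starts k U old k-empty)
          (λ new → ⊥-elim (k-empty n (∈-substʳ (≐-sym (proj₁ new)) (succ-∋ s=n⁺))))

        steps' : Steps g'
        steps' k U j W h k=j⁺ hj = ∨ᶜ-case IsUnion-stable (pair-cases h)
          (λ old → ∨ᶜ-case IsUnion-stable (pair-cases hj)
             (λ old-j → steps k U j W old k=j⁺ old-j)
             (λ new-j → ⊥-elim (s-not-predecessor old k=j⁺ (proj₁ new-j))))
          (λ new → ∨ᶜ-case IsUnion-stable (pair-cases hj)
             (λ old-j →
                let j≐n = succ-injective (IsSucc-substˡ (proj₁ new) k=j⁺) s=n⁺
                in IsUnion-cong (≐-sym (proj₂ new)) (single-valued pV (PairIn-substˡ j≐n old-j)) hV')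
             (λ new-j → ⊥-elim (∈-irrefl
                (∈-substʳ (proj₁ new) (∈-substˡ (proj₁ new-j) (succ-∋ k=j⁺))))))

        extended : IsChain s g'
        extended = bounded' , grounded' , starts' , steps' , ∃ᶜ-intro V' new-pair

      stage-succ : Stage n V → IsSucc s n → ∃ᶜ λ V' → IsUnion V' V × Stage s V'
      stage-succ {V = V} {s = s} sV s=n⁺ κ =
        sV λ { (g , c@(bounded , grounded , starts , steps , _) , pV) →
        union-exists V λ { (V' , hV') → opair-exists s V' λ { (p , hp) →
        singleton-exists p λ { (g₁ , hg₁) → binunion-exists g g₁ λ { (g' , hg') →
          let open Extension bounded grounded starts steps (chain-unique c c) pV s=n⁺ hV' hp hg₁ hg'
          in κ (V' , hV' , ∃ᶜ-intro g' (extended , new-pair)) } } } } }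

      stages-collect : (N : M) → ((n : M) → n ∈ N → ∃ᶜ λ V → Stage n V) →
        ∃ᶜ λ T → (w : M) → (w ∈ T) ⇔ ∃ᶜ (λ n → n ∈ N × ∃ᶜ λ V → Stage n V × w ∈ V)
      stages-collect N staged κ =
        replacement (ex 3 (chainᶠ i 0 3 2 ∧ pairInᶠ i 3 0 1)) 0 1 (const y) N
          (λ n n∈N → ¬¬-map (λ { (V , sV) → V , sV , λ V' sV' → stage-unique sV' sV }) (staged n n∈N))
          λ { (B , hB) → union B λ { (A , hA) →
        comprehension (ex 4 (mem i 4 5 ∧ ex 6 (ex 3 (chainᶠ i 4 3 2 ∧ pairInᶠ i 3 4 6) ∧ mem i 0 6)))
          (const y [ 5 ≔ N ]) A
          (λ w ∃n ¬w∈A → ∃n λ { (n , n∈N , ∃V) → ∃V λ { (V , sV , w∈V) →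
             hB n n∈N λ { (V₁ , V₁∈B , sV₁) →
               hA V₁ w (∈-substʳ (stage-unique sV sV₁) w∈V) V₁∈B ¬w∈A } } })
          κ } }

      -- members of members of the stage V at n belong to the stage ⋃V at n⁺
      collected-transitive : {N T : M} →
        ((n : M) → n ∈ N → ∃ᶜ λ s → IsSucc s n × ((V : M) → Stage s V → s ∈ N)) →
        ((w : M) → (w ∈ T) ⇔ ∃ᶜ (λ n → n ∈ N × ∃ᶜ λ V → Stage n V × w ∈ V)) → tr i T
      collected-transitive next hT t t∈T w w∈t =
        ¬¬-rec negated-stable (λ { (n , n∈N , ∃V) → ¬¬-rec negated-stable (λ { (V , sV , t∈V) →
        ¬¬-rec negated-stable (λ { (s , s=n⁺ , s∈N) → ¬¬-rec negated-stable (λ { (V' , hV' , sV') →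
          let w∈V' = proj₂ (hV' w) (∃ᶜ-intro t (w∈t , t∈V))
          in proj₂ (hT w) (∃ᶜ-intro s (s∈N V' sV' , ∃ᶜ-intro V' (sV' , w∈V'))) })
        (stage-succ sV s=n⁺) }) (next n n∈N) }) ∃V }) (proj₁ (hT t) t∈T)

      transitive-superset : ∃ᶜ λ T → tr i T × ((w : M) → w ∈ y → w ∈ T)
      transitive-superset κ = infinity λ { (I , ∃e , closed) → ∃e λ { (e , e∈I , e-empty) →
        separation (ex 1 (chainᶠ i 0 1 2)) 0 (const y) I λ { (N , hN) →
        let staged : (n : M) → n ∈ N → ∃ᶜ λ V → Stage n V
            staged n n∈N = ¬¬-rec negated-stable (λ { (_ , c) → chain-stage c })
              (proj₂ (proj₁ (hN n) n∈N))
            next : (n : M) → n ∈ N → ∃ᶜ λ s → IsSucc s n × ((V : M) → Stage s V → s ∈ N)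
            next n n∈N =
              ¬¬-map (λ { (s , s∈I , s=n⁺) → s , s=n⁺ , λ V sV → proj₂ (hN s) (s∈I , stage-chain sV) })
              (closed n (proj₁ (proj₁ (hN n) n∈N)))
            base : Stage e y
            base = chain-base e-empty
            e∈N : e ∈ N
            e∈N = proj₂ (hN e) (e∈I , stage-chain base)
        in stages-collect N staged λ { (T , hT) →
          κ (T , collected-transitive next hT
             , λ w w∈y → proj₂ (hT w) (∃ᶜ-intro e (e∈N , ∃ᶜ-intro y (base , w∈y)))) } } } }

    -- TCᵢ(y) is cut out of a transitive superset T as the members of every transitive S ⊇ y
    tc-exists : (y : M) → ∃ᶜ λ u → IsTC i y u
    tc-exists y κ = UnionChain.transitive-superset y λ { (T , T-tr , y⊆T) →
      comprehension (all 30 ((transitiveᶠ i 30 ∧ all 31 (mem i 31 2 ⇒ mem i 31 30)) ⇒ mem i 0 30))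
        (const y) T
        (λ w w∈all → w∈all T (T-tr , y⊆T)) λ { (u , hu) →
      κ (u , (λ t t∈u w w∈t → proj₂ (hu w) λ { S (S-tr , y⊆S) →
                 S-tr t (proj₁ (hu t) t∈u S (S-tr , y⊆S)) w w∈t })
           , (λ v v∈y → proj₂ (hu v) λ { S (_ , y⊆S) → y⊆S v v∈y })
           , (λ S S-tr y⊆S w w∈u → proj₁ (hu w) w∈u S (S-tr , y⊆S))) } }

    tc-⊇ : IsTC i a u → w ∈ a → w ∈ u
    tc-⊇ h = proj₁ (proj₂ h) _

    tc-transitive : IsTC i a u → t ∈ u → w ∈ t → w ∈ u
    tc-transitive h t∈u = proj₁ h _ t∈u _

    InTC-intro : IsTC i a u → t ∈ u → InTC i t a
    InTC-intro h t∈u = ∃ᶜ-intro _ (h , t∈u)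

    ∈⇒InTC : w ∈ a → InTC i w a
    ∈⇒InTC {a = a} w∈a κ = tc-exists a λ { (u , h) → κ (u , h , tc-⊇ h w∈a) }

    InTC-trans : InTC i t a → w ∈ t → InTC i w a
    InTC-trans it w∈t = ¬¬-map (λ { (u , h , t∈u) → u , h , tc-transitive h t∈u w∈t }) it

    -- TCᵢ(x) ∪ {x} is a transitive superset of {x}, hence contains TCᵢ({x}).
    tc-singleton-cases : IsSingleton i s x → IsTC i s u → t ∈ u → t ≐ x ∨ᶜ InTC i t x
    tc-singleton-cases {s = s} {x = x} {t = t} hs hu t∈u κ =
      tc-exists x λ { (v , hv) → binunion-exists v s λ { (W , hW) →
      let W-tr : tr i W
          W-tr r r∈W q q∈r = proj₂ (hW q) (∨ᶜ-inj₁ (∨ᶜ-case negated-stable (proj₁ (hW r) r∈W)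
            (λ r∈v → tc-transitive hv r∈v q∈r)
            (λ r∈s → tc-⊇ hv (∈-substʳ (singleton-≐ hs r∈s) q∈r))))
          t∈W : t ∈ W
          t∈W = proj₂ (proj₂ hu) W W-tr (λ w w∈s → proj₂ (hW w) (∨ᶜ-inj₂ w∈s)) t t∈u
      in ∨ᶜ-case ⊥-stable (proj₁ (hW t) t∈W)
           (λ t∈v → κ (inj₂ (InTC-intro hv t∈v)))
           (λ t∈s → κ (inj₁ (singleton-≐ hs t∈s))) } }

    InTCs-rec : Stable B →
      ((s u : M) → IsSingleton i s x → IsTC i s u → t ∈ u → B) → InTCs i t x → B
    InTCs-rec sb k = ¬¬-rec sb λ { (s , hs , it) →
      ¬¬-rec sb (λ { (u , hu , t∈u) → k s u hs hu t∈u }) it }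

    InTCs-intro : IsSingleton i s x → IsTC i s u → t ∈ u → InTCs i t x
    InTCs-intro hs hu t∈u = ∃ᶜ-intro _ (hs , InTC-intro hu t∈u)

    InTCs-cases : InTCs i t x → t ≐ x ∨ᶜ InTC i t x
    InTCs-cases = InTCs-rec negated-stable λ _ _ hs hu t∈u → tc-singleton-cases hs hu t∈u

    InTCs-self : InTCs i x x
    InTCs-self {x = x} κ = singleton-exists x λ { (s , hs) → tc-exists s λ { (u , hu) →
      InTCs-intro hs hu (tc-⊇ hu (singleton-∋ hs)) κ } }

    InTC⇒InTCs : InTC i t x → InTCs i t x
    InTC⇒InTCs {t = t} {x = x} it κ =
      singleton-exists x λ { (s , hs) → tc-exists s λ { (u , hu) → it λ { (v , hv , t∈v) →
      let x⊆u : (w : M) → w ∈ x → w ∈ u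
          x⊆u w w∈x = tc-transitive hu (tc-⊇ hu (singleton-∋ hs)) w∈x
      in InTCs-intro hs hu (proj₂ (proj₂ hv) u (proj₁ hu) x⊆u t t∈v) κ } } }

    InTCs-trans : InTCs i t x → w ∈ t → InTC i w x
    InTCs-trans its w∈t = ∨ᶜ-case negated-stable (InTCs-cases its)
      (λ t≐x → ∈⇒InTC (∈-substʳ t≐x w∈t))
      (λ it → InTC-trans it w∈t)

  module Agreement (zfc₁ : ZFC one) (zfc₂ : ZFC two) where
    module ZF₁ = ZF one zfc₁
    module ZF₂ = ZF two zfc₂

    app-functional : ψ x y f → App f a b → App f a b' → b ≐ b'
    app-functional ((_ , functional , _) , _) = functional _ _ _

    app-defined : ψ x y f → InTCs one a x → ∃ᶜ λ b → App f a b
    app-defined ((_ , _ , domain) , _) = proj₁ (domain _)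

    app-domain : ψ x y f → App f a b → InTCs one a x
    app-domain ((_ , _ , domain) , _) fab = proj₂ (domain _) (∃ᶜ-intro _ fab)

    app-into : ψ x y f → InTC one t x → ∃ᶜ λ z → App f t z × InTC two z y
    app-into (_ , into , _) = into _

    app-onto : ψ x y f → InTC two q y → ∃ᶜ λ w → InTC one w x × App f w q
    app-onto (_ , _ , onto , _) = onto _

    app-root : ψ x y f → App f x y
    app-root (_ , _ , _ , _ , root) = root

    ∈-image : ψ x y f → InTC one t x → InTCs one w x →
      t ∈⟨ one ⟩ w → App f t z → App f w z' → z ∈⟨ two ⟩ z'
    ∈-image h@(_ , _ , _ , preserves , _) it iw t∈w ftz fwz' =
      ¬¬-rec negated-stable (λ { (z₁ , ∃z₂) →
      ¬¬-rec negated-stable (λ { (z₂ , ftz₁ , fwz₂ , z₁∈z₂) →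
        ∈-substʳ (app-functional h fwz₂ fwz') (∈-substˡ (app-functional h ftz₁ ftz) z₁∈z₂) }) ∃z₂ })
      (proj₁ (preserves _ it _ iw) t∈w)

    ∈-preimage : ψ x y f → InTC one t x → InTCs one w x →
      App f t z → App f w z' → z ∈⟨ two ⟩ z' → t ∈⟨ one ⟩ w
    ∈-preimage (_ , _ , _ , preserves , _) it iw ftz fwz' z∈z' =
      proj₂ (preserves _ it _ iw) (∃ᶜ-intro _ (∃ᶜ-intro _ (ftz , fwz' , z∈z')))

    image-in-TC : ψ x y f → InTCs one t x → App f t z → q ∈⟨ two ⟩ z → InTC two q y
    image-in-TC h t∈x ftz q∈z = ∨ᶜ-case negated-stable (ZF₁.InTCs-cases t∈x)
      (λ t≐x → ZF₂.∈⇒InTC (∈-substʳ (app-functional h (PairIn-substˡ t≐x ftz) (app-root h)) q∈z))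
      (λ t∈TCx → ¬¬-rec negated-stable (λ { (z₀ , ftz₀ , z₀∈TCy) →
         ZF₂.InTC-trans z₀∈TCy (∈-substʳ (app-functional h ftz ftz₀) q∈z) }) (app-into h t∈TCx))

    image-⊆ : ψ x y f → ψ x' y' f' → InTCs one t x → InTCs one t x' →
      ((w a b : M) → w ∈⟨ one ⟩ t → App f w a → App f' w b → a ≐ b) →
      App f t z → App f' t z' → q ∈⟨ two ⟩ z → q ∈⟨ two ⟩ z'
    image-⊆ h h' t∈x t∈x' below ftz f'tz' q∈z = ¬¬-rec negated-stable (λ { (w , w∈x , fwq) →
      let w∈t = ∈-preimage h w∈x t∈x fwq ftz q∈z
          w∈x' = ZF₁.InTCs-trans t∈x' w∈t
      in ¬¬-rec negated-stable (λ { (b , f'wb) →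
           ∈-substˡ (≐-sym (below w _ b w∈t fwq f'wb)) (∈-image h' w∈x' t∈x' w∈t f'wb f'tz') })
         (app-defined h' (ZF₁.InTC⇒InTCs w∈x')) })
      (app-onto h (image-in-TC h t∈x ftz q∈z))

    images-agree-on : ψ x y f → ψ x' y' f' →
      IsSingleton one s x → IsTC one s u → IsSingleton one s' x' → IsTC one s' u' →
      (t : M) → t ∈⟨ one ⟩ u → t ∈⟨ one ⟩ u' → (a b : M) → App f t a × App f' t b → a ≐ b
    images-agree-on {f = f} {f' = f'} {u = u} {u' = u'} h h' hs hu hs' hu' =
      ZF₁.∈-induction u (proj₁ hu)
        (mem one 0 8 ⇒ all 1 (all 2 ((pairInᶠ one 6 0 1 ∧ pairInᶠ one 7 0 2) ⇒ eql 1 2)))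
        ((const f [ 7 ≔ f' ]) [ 8 ≔ u' ])
        λ { t t∈u below t∈u' a b (fta , f'tb) →
          let t∈x = ZF₁.InTCs-intro hs hu t∈u
              t∈x' = ZF₁.InTCs-intro hs' hu' t∈u'
              agree : (w a b : M) → w ∈⟨ one ⟩ t → App f w a → App f' w b → a ≐ b
              agree w a b w∈t fwa f'wb = below w w∈t (ZF₁.tc-transitive hu' t∈u' w∈t) a b (fwa , f'wb)
          in ZF₂.⊆-antisym (λ q → image-⊆ h h' t∈x t∈x' agree fta f'tb)
               (λ q → image-⊆ h' h t∈x' t∈x
                  (λ w a b w∈t f'wa fwb → ≐-sym (agree w b a w∈t fwb f'wa)) f'tb fta) }

    images-agree : ψ x y f → ψ x' y' f' →
      InTCs one t x → InTCs one t x' → App f t a → App f' t b → a ≐ b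
    images-agree h h' t∈x t∈x' fta f'tb =
      ZF₁.InTCs-rec negated-stable (λ _ _ hs hu t∈u →
      ZF₁.InTCs-rec negated-stable (λ _ _ hs' hu' t∈u' →
        images-agree-on h h' hs hu hs' hu' _ t∈u t∈u' _ _ (fta , f'tb)) t∈x') t∈x

    preimage-⊆ : ψ x y f → ψ x' y' f' → InTCs two q y' →
      ((r a b : M) → r ∈⟨ two ⟩ q → App f a r → App f' b r → a ≐ b) →
      App f a q → App f' a' q → c ∈⟨ one ⟩ a → c ∈⟨ one ⟩ a'
    preimage-⊆ h h' q∈y' below faq f'a'q c∈a =
      let a∈x = app-domain h faq
          c∈TCx = ZF₁.InTCs-trans a∈x c∈a
      in ¬¬-rec negated-stable (λ { (r , fcr) →
           let r∈q = ∈-image h c∈TCx a∈x c∈a fcr faq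
           in ¬¬-rec negated-stable (λ { (c' , c'∈TCx' , f'c'r) →
                ∈-substˡ (≐-sym (below r _ c' r∈q fcr f'c'r))
                  (∈-preimage h' c'∈TCx' (app-domain h' f'a'q) f'c'r f'a'q r∈q) })
              (app-onto h' (ZF₂.InTCs-trans q∈y' r∈q)) })
         (app-defined h (ZF₁.InTC⇒InTCs c∈TCx))

    preimages-agree-on : ψ x y f → ψ x' y' f' →
      IsSingleton two s y → IsTC two s u → IsSingleton two s' y' → IsTC two s' u' →
      (q : M) → q ∈⟨ two ⟩ u → q ∈⟨ two ⟩ u' → (a b : M) → App f a q × App f' b q → a ≐ b
    preimages-agree-on {f = f} {f' = f'} {u = u} {u' = u'} h h' hs hu hs' hu' =
      ZF₂.∈-induction u (proj₁ hu)
        (mem two 0 8 ⇒ all 1 (all 2 ((pairInᶠ one 6 1 0 ∧ pairInᶠ one 7 2 0) ⇒ eql 1 2)))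
        ((const f [ 7 ≔ f' ]) [ 8 ≔ u' ])
        λ { q q∈u below q∈u' a b (faq , f'bq) →
          let q∈y = ZF₂.InTCs-intro hs hu q∈u
              q∈y' = ZF₂.InTCs-intro hs' hu' q∈u'
              agree : (r a b : M) → r ∈⟨ two ⟩ q → App f a r → App f' b r → a ≐ b
              agree r a b r∈q far f'br = below r r∈q (ZF₂.tc-transitive hu' q∈u' r∈q) a b (far , f'br)
          in ZF₁.⊆-antisym (λ c → preimage-⊆ h h' q∈y' agree faq f'bq)
               (λ c → preimage-⊆ h' h q∈y
                  (λ r a b r∈q f'ar fbr → ≐-sym (agree r b a r∈q fbr f'ar)) f'bq faq) }

    preimages-agree : ψ x y f → ψ x' y' f' →
      InTCs two q y → InTCs two q y' → App f a q → App f' b q → a ≐ b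
    preimages-agree h h' q∈y q∈y' faq f'bq =
      ZF₂.InTCs-rec negated-stable (λ _ _ hs hu q∈u →
      ZF₂.InTCs-rec negated-stable (λ _ _ hs' hu' q∈u' →
        preimages-agree-on h h' hs hu hs' hu' _ q∈u q∈u' _ _ (faq , f'bq)) q∈y') q∈y

    ∈₁⇒∈₂ : ψ x y f → ψ x' y' f' → x ∈⟨ one ⟩ x' → y ∈⟨ two ⟩ y'
    ∈₁⇒∈₂ {x = x} {x' = x'} h h' x∈x' = ¬¬-rec negated-stable (λ { (b , f'xb) →
        ∈-substˡ (≐-sym (images-agree h h' ZF₁.InTCs-self x∈TCsx' (app-root h) f'xb))
          (∈-image h' (ZF₁.∈⇒InTC x∈x') ZF₁.InTCs-self x∈x' f'xb (app-root h')) })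
      (app-defined h' x∈TCsx')
      where
      x∈TCsx' : InTCs one x x'
      x∈TCsx' = ZF₁.InTC⇒InTCs (ZF₁.∈⇒InTC x∈x')

    ∈₂⇒∈₁ : ψ x y f → ψ x' y' f' → y ∈⟨ two ⟩ y' → x ∈⟨ one ⟩ x'
    ∈₂⇒∈₁ {y = y} {y' = y'} h h' y∈y' = ¬¬-rec negated-stable (λ { (w , w∈TCx' , f'wy) →
        ∈-substˡ (≐-sym (preimages-agree h h' ZF₂.InTCs-self y∈TCsy' (app-root h) f'wy))
          (∈-preimage h' w∈TCx' ZF₁.InTCs-self f'wy (app-root h') y∈y') })
      (app-onto h' (ZF₂.∈⇒InTC y∈y'))
      where
      y∈TCsy' : InTCs two y y'
      y∈TCsy' = ZF₂.InTC⇒InTCs (ZF₂.∈⇒InTC y∈y')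

lemma4 : (𝕄 : Structure) →
    let open InStructure 𝕄 in
    ZFC one → ZFC two →
    (x x' y y' : M) → φ x y → φ x' y' →
    (x ∈⟨ one ⟩ x') ⇔ (y ∈⟨ two ⟩ y')
lemma4 𝕄 zfc₁ zfc₂ x x' y y' φxy φx'y' =
    (λ x∈x' → φ-rec₂ negated-stable φxy φx'y' λ h h' → ∈₁⇒∈₂ h h' x∈x')
  , (λ y∈y' → φ-rec₂ negated-stable φxy φx'y' λ h h' → ∈₂⇒∈₁ h h' y∈y')
  where
  open Theory 𝕄
  open Agreement zfc₁ zfc₂
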